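{- Let $k\ge4$ be a power of $2$ and let $\bar b\in\mathbb N^k$ be v-shaped and s-dominating. Then: (1) $left(half\_split^k(\bar b))$ is v-shaped and s-dominating; (2) $right(half\_split^k(\bar b))$ is bitonic; (3) $left(half\_split^k(\bar b))\succeq right(half\_split^k(\bar b))$.
   Context: A sequence $\langle x_1,\dots,x_m\rangle$ is bitonic if $x_1\le\dots\le x_i\ge\dots\ge x_m$ for some $i$, or it is a circular shift of such a sequence; it is v-shaped if $x_1\ge\dots\ge x_i\le\dots\le x_m$ for some $i$; it is s-dominating if $x_j\ge x_{m-j+1}$ for all $1\le j\le m/2$. $left$ and $right$ denote the first and second halves. $\bar x\succeq\bar y$ means every entry of $\bar x$ is $\ge$ every entry of $\bar y$. A comparator $c_{i,j}$ ($i<j$) puts the maximum of the entries at positions $i,j$ into position $i$ and the minimum into position $j$. $half\_split^k$ applies the comparators $c_{i,k/2+i}$ for $i=k/4+1,\dots,k/2$. -}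

module Defs where

open import Data.Nat using (ℕ; zero; suc; _+_; _*_; _∸_; _^_; _≤_; _<_; _⊔_; _⊓_; _<ᵇ_; _≡ᵇ_)
open import Data.Nat.DivMod using (_/_)
open import Data.Bool using (if_then_else_)
open import Data.Product using (Σ; _×_; ∃-syntax)

-- A sequence of length m is represented as a function  x : ℕ → ℕ,
-- with entries x 0, ..., x (m ∸ 1)  (0-based indexing); values at
-- indices ≥ m are irrelevant: every predicate below only inspects
-- indices < m.
Seq : Set
Seq = ℕ → ℕ

UpDown : ℕ → Seq → Set
UpDown m x = ∃[ i ] (i < m
  × (∀ j l → j ≤ l → l ≤ i → x j ≤ x l)
  × (∀ j l → i ≤ j → j ≤ l → l < m → x l ≤ x j))

VShaped : ℕ → Seq → Set
VShaped m x = ∃[ i ] (i < m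
  × (∀ j l → j ≤ l → l ≤ i → x l ≤ x j)
  × (∀ j l → i ≤ j → j ≤ l → l < m → x j ≤ x l))

rotate : ℕ → ℕ → Seq → Seq
rotate m s x j = if (j + s) <ᵇ m then x (j + s) else x (j + s ∸ m)

Bitonic : ℕ → Seq → Set
Bitonic m x = ∃[ s ] (s < m × UpDown m (rotate m s x))

-- s-dominating: x_j ≥ x_{m-j+1} for all 1 ≤ j ≤ m/2 (1-based);
-- 0-based: for all j with 2(j+1) ≤ m, x (m-1-j) ≤ x j
SDominating : ℕ → Seq → Set
SDominating m x = ∀ j → 2 * suc j ≤ m → x (m ∸ 1 ∸ j) ≤ x j

Dominates : ℕ → Seq → Seq → Set
Dominates m x y = ∀ i j → i < m → j < m → y j ≤ x i

-- first and second halves of a length-k sequence (each of length k / 2)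
left : ℕ → Seq → Seq
left k x = x

right : ℕ → Seq → Seq
right k x j = x (k / 2 + j)

comparator : ℕ → ℕ → Seq → Seq
comparator i j x p =
  if p ≡ᵇ i then x i ⊔ x j else (if p ≡ᵇ j then x i ⊓ x j else x p)

applyComparators : (h i n : ℕ) → Seq → Seq
applyComparators h i zero x = x
applyComparators h i (suc n) x =
  applyComparators h (suc i) n (comparator i (h + i) x)

-- half_split^k: comparators c_{i,k/2+i} for i = k/4+1, …, k/2 (1-based),
-- i.e. 0-based i = k/4, …, k/2 - 1 (k/4 comparators)
halfSplit : ℕ → Seq → Seq
halfSplit k = applyComparators (k / 2) (k / 4) (k / 4)

-- A sequence is v-shaped iff it is quasi-convex (b c ≤ b a ⊔ b d for a ≤ c ≤ d).
-- For i < k/4 the s-domination of b together with quasi-convexity gives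
-- b (k/2 + i) ≤ b i, so the comparators omitted by half_split would not have
-- moved anything: the left half becomes max (b i) (b (k/2 + i)) and the right
-- half min (b i) (b (k/2 + i)) at every position.  A pointwise maximum of
-- quasi-convex sequences is quasi-convex, and every entry of the maximum
-- dominates every entry of the minimum by quasi-convexity of b.  The minimum
-- is not quasi-concave in general, but its superlevel sets are arcs of the
-- cycle; rotating it to start at its minimum makes it quasi-concave, hence
-- a rotation of an up-down sequence.
module Submission where

open import Data.Nat
open import Data.Nat.DivMod using (m*n/n≡m)
open import Data.Nat.Properties
open import Data.Product using (_×_; _,_; proj₁; proj₂; ∃-syntax)
open import Data.Sum using (_⊎_; inj₁; inj₂; [_,_]′)
open import Function using (_∘_)
open import Relation.Binary.Definitions using (Reflexive; Transitive; Total)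
open import Relation.Binary.PropositionalEquality
open import Relation.Nullary using (yes; no; contradiction)
open import Relation.Nullary.Decidable using (dec-true; dec-false)

open import Defs

open ≤-Reasoning

comparator-max : ∀ i j x → comparator i j x i ≡ x i ⊔ x j
comparator-max i j x rewrite dec-true (i ≟ i) refl = refl

comparator-min : ∀ {i j} x → i ≢ j → comparator i j x j ≡ x i ⊓ x j
comparator-min {i} {j} x i≢j
  rewrite dec-false (j ≟ i) (i≢j ∘ sym) | dec-true (j ≟ j) refl = refl

comparator-other : ∀ {i j p} x → p ≢ i → p ≢ j → comparator i j x p ≡ x p
comparator-other {i} {j} {p} x p≢i p≢j
  rewrite dec-false (p ≟ i) p≢i | dec-false (p ≟ j) p≢j = refl

applyComparators-below : ∀ {h i n p} x → p < i → i + n ≤ h →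
  applyComparators h i n x p ≡ x p × applyComparators h i n x (h + p) ≡ x (h + p)
applyComparators-below {n = zero} x _ _ = refl , refl
applyComparators-below {h} {i} {suc n} {p} x p<i i+n≤h
  with applyComparators-below {n = n} (comparator i (h + i) x)
         (m<n⇒m<1+n p<i) (subst (_≤ h) (+-suc i n) i+n≤h)
... | e₁ , e₂ =
  trans e₁ (comparator-other x (<⇒≢ p<i) (<⇒≢ (<-≤-trans p<i (m≤n+m i h)))) ,
  trans e₂ (comparator-other x (>⇒≢ i<h+p) (<⇒≢ p<i ∘ +-cancelˡ-≡ h p i))
  where
  i<h+p : i < h + p
  i<h+p = <-≤-trans (<-≤-trans (m<m+n i z<s) i+n≤h) (m≤m+n h p)

applyComparators-pair : ∀ {h i n p} x → i ≤ p → p < i + n → i + n ≤ h →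
  applyComparators h i n x p ≡ x p ⊔ x (h + p) ×
  applyComparators h i n x (h + p) ≡ x p ⊓ x (h + p)
applyComparators-pair {i = i} {zero} x i≤p p<i+0 _ =
  contradiction (subst (_ <_) (+-identityʳ i) p<i+0) (≤⇒≯ i≤p)
applyComparators-pair {h} {i} {suc n} {p} x i≤p p<i+n i+n≤h
  with m≤n⇒m<n∨m≡n i≤p
... | inj₂ refl with applyComparators-below {n = n} (comparator p (h + p) x) (n<1+n p)
                      (subst (_≤ h) (+-suc p n) i+n≤h)
...   | e₁ , e₂ = trans e₁ (comparator-max p (h + p) x) ,
                  trans e₂ (comparator-min x (<⇒≢ p<h+p))
  where
  p<h+p : p < h + p
  p<h+p = <-≤-trans (<-≤-trans (m<m+n p z<s) i+n≤h) (m≤m+n h p)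
applyComparators-pair {h} {i} {suc n} {p} x i≤p p<i+n i+n≤h
    | inj₁ i<p with applyComparators-pair {n = n} (comparator i (h + i) x)
                      i<p (subst (p <_) (+-suc i n) p<i+n) (subst (_≤ h) (+-suc i n) i+n≤h)
...   | e₁ , e₂ = trans e₁ (cong₂ _⊔_ y-p y-h+p) , trans e₂ (cong₂ _⊓_ y-p y-h+p)
  where
  p<h : p < h
  p<h = <-≤-trans p<i+n i+n≤h
  y-p : comparator i (h + i) x p ≡ x p
  y-p = comparator-other x (>⇒≢ i<p) (<⇒≢ (<-≤-trans p<h (m≤m+n h i)))
  y-h+p : comparator i (h + i) x (h + p) ≡ x (h + p)
  y-h+p = comparator-other x (>⇒≢ (<-≤-trans (<-trans i<p p<h) (m≤m+n h p)))
                             (>⇒≢ i<p ∘ +-cancelˡ-≡ h p i)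

rotate-< : ∀ {m} f s j → j + s < m → rotate m s f j ≡ f (j + s)
rotate-< {m} f s j j+s<m rewrite dec-true (j + s <? m) j+s<m = refl

rotate-≥ : ∀ {m} f s j → m ≤ j + s → rotate m s f j ≡ f (j + s ∸ m)
rotate-≥ {m} f s j m≤j+s rewrite dec-false (j + s <? m) (≤⇒≯ m≤j+s) = refl

QuasiConvex : ℕ → Seq → Set
QuasiConvex m f = ∀ a c d → a ≤ c → c ≤ d → d < m → f c ≤ f a ⊔ f d

QuasiConcave : ℕ → Seq → Set
QuasiConcave m f = ∀ a c d → a ≤ c → c ≤ d → d < m → f a ⊓ f d ≤ f c

-- v lies on the arc of the cycle [0, m) from u to w, and y on the opposite
-- arc; equivalently, every superlevel set of f is an arc of the cycle.
CyclicallyQuasiConcave : ℕ → Seq → Set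
CyclicallyQuasiConcave m f = ∀ u v w y → u ≤ v → v ≤ w → w < m → y < m →
  y ≤ u ⊎ w ≤ y → f v ⊓ f y ≤ f u ⊔ f w

module _ {_≼_ : ℕ → ℕ → Set}
         (≼-refl : Reflexive _≼_) (≼-trans : Transitive _≼_) (≼-total : Total _≼_) where

  extremum : ∀ n (f : Seq) → ∃[ p ] (p < suc n × ∀ {j} → j < suc n → f p ≼ f j)
  extremum zero f = 0 , z<s , λ { (s≤s z≤n) → ≼-refl }
  extremum (suc n) f with extremum n f
  ... | p , p<1+n , best with ≼-total (f p) (f (suc n))
  ...   | inj₁ fp≼ = p , m<n⇒m<1+n p<1+n , [ best , (λ { refl → fp≼ }) ]′ ∘ m<1+n⇒m<n∨m≡n
  ...   | inj₂ ≼fp = suc n , ≤-refl , [ ≼-trans ≼fp ∘ best , (λ { refl → ≼-refl }) ]′ ∘ m<1+n⇒m<n∨m≡n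

argmin : ∀ n (f : Seq) → ∃[ p ] (p < suc n × ∀ {j} → j < suc n → f p ≤ f j)
argmin = extremum ≤-refl ≤-trans ≤-total

argmax : ∀ n (f : Seq) → ∃[ p ] (p < suc n × ∀ {j} → j < suc n → f j ≤ f p)
argmax = extremum ≤-refl (λ p q → ≤-trans q p) (λ x y → ≤-total y x)

vShaped⇒quasiConvex : ∀ {m f} → VShaped m f → QuasiConvex m f
vShaped⇒quasiConvex {f = f} (p , _ , down , up) a c d a≤c c≤d d<m with ≤-total c p
... | inj₁ c≤p = ≤-trans (down a c a≤c c≤p) (m≤m⊔n (f a) (f d))
... | inj₂ p≤c = ≤-trans (up c d p≤c c≤d d<m) (m≤n⊔m (f a) (f d))

quasiConvex⇒vShaped : ∀ {m f} → 0 < m → QuasiConvex m f → VShaped m f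
quasiConvex⇒vShaped {suc n} {f} _ qc with argmin n f
... | p , p<m , minimal =
  p , p<m ,
  (λ j l j≤l l≤p → ≤-trans (qc j l p j≤l l≤p p<m)
                            (⊔-lub ≤-refl (minimal (≤-<-trans (≤-trans j≤l l≤p) p<m)))) ,
  (λ j l p≤j j≤l l<m → ≤-trans (qc p j l p≤j j≤l l<m) (⊔-lub (minimal l<m) ≤-refl))

quasiConcave⇒upDown : ∀ {m f} → 0 < m → QuasiConcave m f → UpDown m f
quasiConcave⇒upDown {suc n} {f} _ qc with argmax n f
... | p , p<m , maximal =
  p , p<m ,
  (λ j l j≤l l≤p → ≤-trans (⊓-glb ≤-refl (maximal (≤-<-trans (≤-trans j≤l l≤p) p<m)))
                            (qc j l p j≤l l≤p p<m)) ,
  (λ j l p≤j j≤l l<m → ≤-trans (⊓-glb (maximal l<m) ≤-refl) (qc p j l p≤j j≤l l<m))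

-- Rotate so that the sequence starts at a minimum s.  For a ≤ c ≤ d, either
-- c does not wrap around and s, a, c (shifted) bound an arc avoiding d, or it
-- does and c, d, s bound an arc avoiding a; in both cases f s is absorbed by
-- the maximum.
cyclicallyQuasiConcave⇒bitonic : ∀ {m f} → 0 < m → CyclicallyQuasiConcave m f → Bitonic m f
cyclicallyQuasiConcave⇒bitonic {suc n} {f} _ cqc with argmin n f
... | s , s<m , minimal = s , s<m , quasiConcave⇒upDown z<s rotated
  where
  m = suc n
  z = rotate m s f

  wrapped≤s : ∀ {j} → j < m → j + s ∸ m ≤ s
  wrapped≤s j<m = ≤-trans (∸-monoˡ-≤ m (+-monoˡ-≤ s (<⇒≤ j<m))) (≤-reflexive (m+n∸m≡n m s))

  wrapped<m : ∀ {j} → j < m → j + s ∸ m < m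
  wrapped<m j<m = ≤-<-trans (wrapped≤s j<m) s<m

  unwrapped-c : ∀ {a c d y} → a ≤ c → c + s < m → y < m → y ≤ s ⊎ c + s ≤ y →
                z d ≡ f y → z a ⊓ z d ≤ z c
  unwrapped-c {a} {c} {d} {y} a≤c c+s<m y<m y-out zd≡fy = begin
    z a ⊓ z d        ≡⟨ cong₂ _⊓_ (rotate-< f s a (≤-<-trans (+-monoˡ-≤ s a≤c) c+s<m)) zd≡fy ⟩
    f (a + s) ⊓ f y  ≤⟨ cqc s (a + s) (c + s) y (m≤n+m s a) (+-monoˡ-≤ s a≤c) c+s<m y<m y-out ⟩
    f s ⊔ f (c + s)  ≡⟨ m≤n⇒m⊔n≡n (minimal c+s<m) ⟩
    f (c + s)        ≡⟨ rotate-< f s c c+s<m ⟨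
    z c              ∎

  wrapped-c : ∀ {a c d y} → c ≤ d → d < m → m ≤ c + s → y < m → y ≤ c + s ∸ m ⊎ s ≤ y →
              z a ≡ f y → z a ⊓ z d ≤ z c
  wrapped-c {a} {c} {d} {y} c≤d d<m m≤c+s y<m y-out za≡fy = begin
    z a ⊓ z d                  ≡⟨ ⊓-comm (z a) (z d) ⟩
    z d ⊓ z a                  ≡⟨ cong₂ _⊓_ (rotate-≥ f s d (≤-trans m≤c+s (+-monoˡ-≤ s c≤d))) za≡fy ⟩
    f (d + s ∸ m) ⊓ f y        ≤⟨ cqc (c + s ∸ m) (d + s ∸ m) s y (∸-monoˡ-≤ m (+-monoˡ-≤ s c≤d))
                                      (wrapped≤s d<m) s<m y<m y-out ⟩
    f (c + s ∸ m) ⊔ f s        ≡⟨ m≥n⇒m⊔n≡m (minimal (wrapped<m (≤-<-trans c≤d d<m))) ⟩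
    f (c + s ∸ m)              ≡⟨ rotate-≥ f s c m≤c+s ⟨
    z c                        ∎

  rotated : QuasiConcave m z
  rotated a c d a≤c c≤d d<m with c + s <? m | d + s <? m | a + s <? m
  ... | yes c+s<m | yes d+s<m | _ =
    unwrapped-c a≤c c+s<m d+s<m (inj₂ (+-monoˡ-≤ s c≤d)) (rotate-< f s d d+s<m)
  ... | yes c+s<m | no d+s≮m  | _ =
    unwrapped-c a≤c c+s<m (wrapped<m d<m) (inj₁ (wrapped≤s d<m)) (rotate-≥ f s d (≮⇒≥ d+s≮m))
  ... | no c+s≮m  | _ | yes a+s<m =
    wrapped-c c≤d d<m (≮⇒≥ c+s≮m) a+s<m (inj₂ (m≤n+m s a)) (rotate-< f s a a+s<m)
  ... | no c+s≮m  | _ | no a+s≮m  =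
    wrapped-c c≤d d<m (≮⇒≥ c+s≮m) (wrapped<m (≤-<-trans (≤-trans a≤c c≤d) d<m))
      (inj₁ (∸-monoˡ-≤ m (+-monoˡ-≤ s a≤c))) (rotate-≥ f s a (≮⇒≥ a+s≮m))

mirror-bounds : ∀ {h j} → 2 * suc j ≤ h → j ≤ h ∸ 1 ∸ j × h ∸ 1 ∸ j + j < h
mirror-bounds {suc h} {j} (s≤s 1+2j≤h) =
  m+n≤o⇒m≤o∸n j 2j≤h , s≤s (≤-reflexive (m∸n+n≡m (≤-trans (m≤m+n j j) 2j≤h)))
  where
  2j≤h : j + j ≤ h
  2j≤h = ≤-trans (+-monoʳ-≤ j (≤-trans (≤-reflexive (sym (+-identityʳ j))) (n≤1+n _))) 1+2j≤h

quasiConvex-cong : ∀ {m f g} → (∀ {i} → i < m → f i ≡ g i) → QuasiConvex m g → QuasiConvex m f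
quasiConvex-cong f≗g qc a c d a≤c c≤d d<m =
  subst₂ _≤_ (sym (f≗g c<m)) (sym (cong₂ _⊔_ (f≗g (≤-<-trans a≤c c<m)) (f≗g d<m)))
    (qc a c d a≤c c≤d d<m)
  where
  c<m = ≤-<-trans c≤d d<m

cyclicallyQuasiConcave-cong : ∀ {m f g} → (∀ {i} → i < m → f i ≡ g i) →
                              CyclicallyQuasiConcave m g → CyclicallyQuasiConcave m f
cyclicallyQuasiConcave-cong f≗g cqc u v w y u≤v v≤w w<m y<m y-out =
  subst₂ _≤_ (sym (cong₂ _⊓_ (f≗g v<m) (f≗g y<m)))
             (sym (cong₂ _⊔_ (f≗g (≤-<-trans u≤v v<m)) (f≗g w<m)))
    (cqc u v w y u≤v v≤w w<m y<m y-out)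
  where
  v<m = ≤-<-trans v≤w w<m

sDominating-cong : ∀ {m f g} → (∀ {i} → i < m → f i ≡ g i) → SDominating m g → SDominating m f
sDominating-cong f≗g sd j 2+2j≤m with mirror-bounds 2+2j≤m
... | j≤r , r+j<m =
  subst₂ _≤_ (sym (f≗g r<m)) (sym (f≗g (≤-<-trans j≤r r<m))) (sd j 2+2j≤m)
  where
  r<m = ≤-<-trans (m≤m+n _ j) r+j<m

dominates-cong : ∀ {m f f′ g g′} → (∀ {i} → i < m → f i ≡ f′ i) → (∀ {i} → i < m → g i ≡ g′ i) →
                 Dominates m f′ g′ → Dominates m f g
dominates-cong f≗f′ g≗g′ dom i j i<m j<m =
  subst₂ _≤_ (sym (g≗g′ j<m)) (sym (f≗f′ i<m)) (dom i j i<m j<m)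

⊓-≤-split : ∀ {a c t} → a ⊓ c ≤ t → a ≤ t ⊎ c ≤ t
⊓-≤-split {a} {c} a⊓c≤t with ⊓-sel a c
... | inj₁ a⊓c≡a = inj₁ (subst (_≤ _) a⊓c≡a a⊓c≤t)
... | inj₂ a⊓c≡c = inj₂ (subst (_≤ _) a⊓c≡c a⊓c≤t)

quasiConvex-between : ∀ {m f a c d t} → QuasiConvex m f → a ≤ c → c ≤ d → d < m →
                      f a ≤ t → f d ≤ t → f c ≤ t
quasiConvex-between qc a≤c c≤d d<m fa≤t fd≤t = ≤-trans (qc _ _ _ a≤c c≤d d<m) (⊔-lub fa≤t fd≤t)

sDominating-interval : ∀ {m f i r} → QuasiConvex m f → SDominating m f →
                       2 * suc i ≤ m → i ≤ r → r + i < m → f r ≤ f i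
sDominating-interval {suc m} {f} {i} {r} qc sd 2+2i≤m i≤r (s≤s r+i≤m) =
  quasiConvex-between qc i≤r (m+n≤o⇒m≤o∸n r r+i≤m) (s≤s (m∸n≤m m i)) ≤-refl (sd i 2+2i≤m)

m<n⇒m<2*n : ∀ {m n} → m < n → m < 2 * n
m<n⇒m<2*n {n = n} m<n = <-≤-trans m<n (m≤m+n n (n + 0))

m<n⇒n+m<2*n : ∀ {m n} → m < n → n + m < 2 * n
m<n⇒n+m<2*n {m} {n} m<n = +-monoʳ-< n (subst (m <_) (sym (+-identityʳ n)) m<n)

maxHalf minHalf : ℕ → Seq → Seq
maxHalf h b i = b i ⊔ b (h + i)
minHalf h b i = b i ⊓ b (h + i)

module _ {h : ℕ} {b : Seq} (qc : QuasiConvex (2 * h) b) where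

  maxHalf-quasiConvex : QuasiConvex h (maxHalf h b)
  maxHalf-quasiConvex a c d a≤c c≤d d<h = ⊔-lub
    (≤-trans (qc a c d a≤c c≤d (m<n⇒m<2*n d<h))
             (⊔-mono-≤ (m≤m⊔n (b a) (b (h + a))) (m≤m⊔n (b d) (b (h + d)))))
    (≤-trans (qc (h + a) (h + c) (h + d) (+-monoʳ-≤ h a≤c) (+-monoʳ-≤ h c≤d) (m<n⇒n+m<2*n d<h))
             (⊔-mono-≤ (m≤n⊔m (b a) (b (h + a))) (m≤n⊔m (b d) (b (h + d)))))

  maxHalf-dominates-minHalf : Dominates h (maxHalf h b) (minHalf h b)
  maxHalf-dominates-minHalf i j i<h j<h with ≤-total i j
  ... | inj₁ i≤j = ≤-trans (m⊓n≤m _ _)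
    (qc i j (h + i) i≤j (≤-trans (<⇒≤ j<h) (m≤m+n h i)) (m<n⇒n+m<2*n i<h))
  ... | inj₂ j≤i = ≤-trans (m⊓n≤n _ _)
    (qc i (h + j) (h + i) (≤-trans (<⇒≤ i<h) (m≤m+n h j)) (+-monoʳ-≤ h j≤i) (m<n⇒n+m<2*n i<h))

  minHalf-cyclicallyQuasiConcave : CyclicallyQuasiConcave h (minHalf h b)
  minHalf-cyclicallyQuasiConcave u v w y u≤v v≤w w<h y<h y-out
    with ⊓-≤-split (m≤m⊔n (minHalf h b u) (minHalf h b w))
       | ⊓-≤-split (m≤n⊔m (minHalf h b u) (minHalf h b w))
  ... | inj₁ bu≤t | inj₁ bw≤t = ≤-trans (m⊓n≤m _ _) (≤-trans (m⊓n≤m _ _)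
    (quasiConvex-between qc u≤v v≤w (m<n⇒m<2*n w<h) bu≤t bw≤t))
  ... | inj₂ bu≤t | inj₂ bw≤t = ≤-trans (m⊓n≤m _ _) (≤-trans (m⊓n≤n _ _)
    (quasiConvex-between qc (+-monoʳ-≤ h u≤v) (+-monoʳ-≤ h v≤w) (m<n⇒n+m<2*n w<h) bu≤t bw≤t))
  ... | inj₁ bu≤t | inj₂ bw≤t = ≤-trans (m⊓n≤n _ _) (across y-out)
    where
    across : y ≤ u ⊎ w ≤ y → minHalf h b y ≤ _
    across (inj₁ y≤u) = ≤-trans (m⊓n≤n _ _) (quasiConvex-between qc
      (≤-trans (<⇒≤ (≤-<-trans u≤v (≤-<-trans v≤w w<h))) (m≤m+n h y))
      (+-monoʳ-≤ h (≤-trans y≤u (≤-trans u≤v v≤w))) (m<n⇒n+m<2*n w<h) bu≤t bw≤t)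
    across (inj₂ w≤y) = ≤-trans (m⊓n≤m _ _) (quasiConvex-between qc
      (≤-trans u≤v (≤-trans v≤w w≤y)) (≤-trans (<⇒≤ y<h) (m≤m+n h w)) (m<n⇒n+m<2*n w<h) bu≤t bw≤t)
  ... | inj₂ bu≤t | inj₁ bw≤t = ≤-trans (m⊓n≤n _ _) (across y-out)
    where
    u<h = ≤-<-trans u≤v (≤-<-trans v≤w w<h)
    across : y ≤ u ⊎ w ≤ y → minHalf h b y ≤ _
    across (inj₁ y≤u) = ≤-trans (m⊓n≤n _ _) (quasiConvex-between qc
      (≤-trans (<⇒≤ w<h) (m≤m+n h y)) (+-monoʳ-≤ h y≤u) (m<n⇒n+m<2*n u<h) bw≤t bu≤t)
    across (inj₂ w≤y) = ≤-trans (m⊓n≤m _ _) (quasiConvex-between qc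
      w≤y (≤-trans (<⇒≤ y<h) (m≤m+n h u)) (m<n⇒n+m<2*n u<h) bw≤t bu≤t)

  maxHalf-sDominating : SDominating (2 * h) b → SDominating h (maxHalf h b)
  maxHalf-sDominating sd j 2+2j≤h with mirror-bounds 2+2j≤h
  ... | j≤r , r+j<h = ⊔-lub
    (≤-trans (sDominating-interval qc sd 2+2j≤2h j≤r (<-≤-trans r+j<h (m≤m+n h (h + 0))))
             (m≤m⊔n _ _))
    (≤-trans (sDominating-interval qc sd 2+2j≤2h (≤-trans j≤r (m≤n+m _ h))
               (subst (_< 2 * h) (sym (+-assoc h _ j)) (m<n⇒n+m<2*n r+j<h)))
             (m≤m⊔n _ _))
    where
    2+2j≤2h : 2 * suc j ≤ 2 * h
    2+2j≤2h = ≤-trans 2+2j≤h (m≤m+n h (h + 0))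

2*n/2≡n : ∀ n → 2 * n / 2 ≡ n
2*n/2≡n n = trans (cong (_/ 2) (*-comm 2 n)) (m*n/n≡m n 2)

2*[2*n]/4≡n : ∀ n → 2 * (2 * n) / 4 ≡ n
2*[2*n]/4≡n n = trans (cong (_/ 4) (trans (sym (*-assoc 2 2 n)) (*-comm 4 n))) (m*n/n≡m n 4)

module _ {q : ℕ} {b : Seq} (qc : QuasiConvex (2 * (2 * q)) b) (sd : SDominating (2 * (2 * q)) b) where

  private
    h = 2 * q
    k = 2 * h

    q+q≡h : q + q ≡ h
    q+q≡h = cong (q +_) (sym (+-identityʳ q))

    halfSplit≡comparators : halfSplit k b ≡ applyComparators h q q b
    halfSplit≡comparators = cong₂ (λ H Q → applyComparators H Q Q b) (2*n/2≡n h) (2*[2*n]/4≡n q)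

    ordered-below-q : ∀ {i} → i < q → b (h + i) ≤ b i
    ordered-below-q {i} i<q = sDominating-interval qc sd
      (m<n⇒m<2*n (*-monoʳ-≤ 2 i<q)) (m≤n+m i h)
      (subst (_< k) (sym (+-assoc h i i))
        (m<n⇒n+m<2*n (+-mono-< i<q (subst (i <_) (sym (+-identityʳ q)) i<q))))

  halfSplit-left : ∀ {i} → i < h → halfSplit k b i ≡ maxHalf h b i
  halfSplit-left {i} i<h with i <? q
  ... | yes i<q = begin-equality
    halfSplit k b i                  ≡⟨ cong-app halfSplit≡comparators i ⟩
    applyComparators h q q b i       ≡⟨ proj₁ (applyComparators-below b i<q (≤-reflexive q+q≡h)) ⟩
    b i                              ≡⟨ m≥n⇒m⊔n≡m (ordered-below-q i<q) ⟨
    maxHalf h b i                    ∎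
  ... | no i≮q = trans (cong-app halfSplit≡comparators i)
    (proj₁ (applyComparators-pair b (≮⇒≥ i≮q) (subst (i <_) (sym q+q≡h) i<h) (≤-reflexive q+q≡h)))

  halfSplit-right : ∀ {j} → j < h → right k (halfSplit k b) j ≡ minHalf h b j
  halfSplit-right {j} j<h with j <? q
  ... | yes j<q = begin-equality
    halfSplit k b (k / 2 + j)            ≡⟨ cong-app halfSplit≡comparators (k / 2 + j) ⟩
    applyComparators h q q b (k / 2 + j) ≡⟨ cong (applyComparators h q q b ∘ (_+ j)) (2*n/2≡n h) ⟩
    applyComparators h q q b (h + j)     ≡⟨ proj₂ (applyComparators-below b j<q (≤-reflexive q+q≡h)) ⟩
    b (h + j)                            ≡⟨ m≥n⇒m⊓n≡n (ordered-below-q j<q) ⟨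
    minHalf h b j                        ∎
  ... | no j≮q = trans (cong-app halfSplit≡comparators (k / 2 + j))
    (trans (cong (applyComparators h q q b ∘ (_+ j)) (2*n/2≡n h))
      (proj₂ (applyComparators-pair b (≮⇒≥ j≮q) (subst (j <_) (sym q+q≡h) j<h) (≤-reflexive q+q≡h))))

lemma5 : (n : ℕ) → 2 ≤ n → (b : Seq) →
           VShaped (2 ^ n) b → SDominating (2 ^ n) b →
           (VShaped (2 ^ n / 2) (left (2 ^ n) (halfSplit (2 ^ n) b))
             × SDominating (2 ^ n / 2) (left (2 ^ n) (halfSplit (2 ^ n) b)))
           × Bitonic (2 ^ n / 2) (right (2 ^ n) (halfSplit (2 ^ n) b))
           × Dominates (2 ^ n / 2) (left (2 ^ n) (halfSplit (2 ^ n) b))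
               (right (2 ^ n) (halfSplit (2 ^ n) b))
lemma5 (suc (suc n)) (s≤s (s≤s z≤n)) b vb sd =
  subst (λ M → (VShaped M L × SDominating M L) × Bitonic M R × Dominates M L R) (sym (2*n/2≡n h))
    ( ( quasiConvex⇒vShaped 0<h (quasiConvex-cong L≗max (maxHalf-quasiConvex qc))
      , sDominating-cong L≗max (maxHalf-sDominating qc sd))
    , cyclicallyQuasiConcave⇒bitonic 0<h
        (cyclicallyQuasiConcave-cong R≗min (minHalf-cyclicallyQuasiConcave qc))
    , dominates-cong L≗max R≗min (maxHalf-dominates-minHalf qc))
  where
  h = 2 * 2 ^ n
  L = halfSplit (2 * h) b
  R = right (2 * h) L
  0<h : 0 < h
  0<h = m<n⇒m<2*n (m^n>0 2 n)
  qc : QuasiConvex (2 * h) b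
  qc = vShaped⇒quasiConvex vb
  L≗max : ∀ {i} → i < h → L i ≡ maxHalf h b i
  L≗max = halfSplit-left {q = 2 ^ n} qc sd
  R≗min : ∀ {j} → j < h → R j ≡ minHalf h b j
  R≗min = halfSplit-right {q = 2 ^ n} qc sd
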